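{- Let $\vec{x}=(x_1,\ldots,x_t)$ be a generalized Catalan list of nonzero integers. If ${\sf cost}(\vec{x})<{\sf width}(\vec{x})$, then $\vec{x}$ is reducible.
   Context: A list $\vec{x}=(x_1,\ldots,x_t)$ of nonzero integers is generalized Catalan if $\sum_{i=1}^t x_i=0$ and $\sum_{i=1}^q x_i\ge 0$ for all $1\le q\le t$. A sublist is a list $(x_{i_1},\ldots,x_{i_a})$ with $i_1<\cdots<i_a$; the complementary sublist consists of the remaining entries in their original order. $\vec{x}$ is reducible if there is a generalized Catalan sublist whose complementary sublist is also generalized Catalan (so both are nonempty). A run is a maximal consecutive sublist of entries of the same sign; a generalized Catalan list has an even number $2y$ of runs. If $a_k>0$ is the maximum absolute value of an entry in the $k$-th run, then ${\sf cost}(\vec{x})=\sum_{k=1}^{2y}a_k$ and ${\sf width}(\vec{x})=t$. -}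

module Defs where

open import Data.Bool using (Bool; true; false)
open import Data.Nat using (ℕ; zero; suc; _⊔_) renaming (_+_ to _+ℕ_)
open import Data.Integer using (ℤ; +_; _+_; _≤_; ∣_∣; 0ℤ) renaming (_<_ to _<ℤ_)
open import Data.List using (List; []; _∷_; length; take)
open import Data.List.Relation.Unary.All using (All)
open import Data.Product using (_×_; _,_; proj₁; proj₂; ∃)
open import Relation.Binary.PropositionalEquality using (_≡_; _≢_)
open import Relation.Nullary using (¬_)

-- Positive entries (> 0) ; entries are assumed nonzero in all uses.
positive? : ℤ → Bool
positive? (+ zero)  = false
positive? (+ suc _) = true
positive? _         = false

sumℤ : List ℤ → ℤ
sumℤ [] = 0ℤ
sumℤ (x ∷ xs) = x + sumℤ xs

record GenCatalan (xs : List ℤ) : Set where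
  field
    nonempty : xs ≢ []
    nonzero  : All (λ x → x ≢ 0ℤ) xs
    sumZero  : sumℤ xs ≡ 0ℤ
    prefixNonneg : (q : ℕ) → 0ℤ ≤ sumℤ (take q xs)

split : List Bool → List ℤ → List ℤ × List ℤ
split (true  ∷ bs) (x ∷ xs) = let r = split bs xs in (x ∷ proj₁ r , proj₂ r)
split (false ∷ bs) (x ∷ xs) = let r = split bs xs in (proj₁ r , x ∷ proj₂ r)
split _ _ = ([] , [])

sublist : List Bool → List ℤ → List ℤ
sublist bs xs = proj₁ (split bs xs)

complement : List Bool → List ℤ → List ℤ
complement bs xs = proj₂ (split bs xs)

Reducible : List ℤ → Set
Reducible xs = ∃ λ (bs : List Bool) →
  length bs ≡ length xs × GenCatalan (sublist bs xs) × GenCatalan (complement bs xs)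

runs : List ℤ → List (List ℤ)
runs [] = []
runs (x ∷ xs) with runs xs
... | [] = (x ∷ []) ∷ []
... | ((y ∷ ys) ∷ rs) with positive? x | positive? y
...   | true  | true  = (x ∷ y ∷ ys) ∷ rs
...   | false | false = (x ∷ y ∷ ys) ∷ rs
...   | _     | _     = (x ∷ []) ∷ (y ∷ ys) ∷ rs
runs (x ∷ xs) | ([] ∷ rs) = (x ∷ []) ∷ rs

maxAbs : List ℤ → ℕ
maxAbs [] = 0
maxAbs (x ∷ xs) = ∣ x ∣ ⊔ maxAbs xs

sumℕ : List ℕ → ℕ
sumℕ [] = 0
sumℕ (n ∷ ns) = n +ℕ sumℕ ns

mapL : {A B : Set} → (A → B) → List A → List B
mapL f [] = []
mapL f (a ∷ as) = f a ∷ mapL f as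

cost : List ℤ → ℕ
cost xs = sumℕ (mapL maxAbs (runs xs))

width : List ℤ → ℕ
width = length

-- Read the list as a walk from height 0 that never goes below 0 and returns to 0. Its runs pair up
-- into peaks, an ascent followed by a descent; with p and n the sums of the largest steps of the
-- ascents and of the descents, cost = p + n, while width = #positive + #negative entries. So
-- n < #positive or p < #negative, and since reversing and negating the list swaps the two, we may
-- assume n < #positive and induct on the length.
-- At the first peak an ascent A is followed by a descent B down to height h₀; let T be the part of A
-- above h₀. If T has more steps than max B: the first level of B above each step start of T lies at
-- most max B higher, so by pigeonhole two step starts have the same gap, and the segment of T between
-- them rises as much as a segment of B. These two segments form a Catalan sublist whose complement is
-- still a walk. Otherwise either h₀ is a step start of A and T together with B can be cut out, or the
-- part of the peak above the step crossing h₀ collapses to a single step of a shorter list that still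
-- satisfies n < #positive, and its reduction lifts back.

module Submission where

open import Defs
open import Data.Bool using (Bool; true; false; not; if_then_else_)
open import Data.Empty using (⊥-elim)
open import Data.Integer as ℤ using (ℤ; +_; -_; -[1+_]; 0ℤ; +≤+) renaming (_+_ to _+ℤ_)
import Data.Integer.Properties as ℤ
open import Data.Integer.Tactic.RingSolver using (solve-∀)
open import Data.List using (List; []; _∷_; _++_; length; map; reverse; replicate; take; foldr; concat; [_])
open import Data.List.Membership.Propositional using (find)
open import Data.List.Membership.Propositional.Properties using (∈-∃++)
open import Data.List.Properties
  using ( ∷-injectiveˡ; ∷-injectiveʳ; ++-assoc; ++-identityʳ; ++-conicalˡ; ++-conicalʳ; ++-monoid
        ; length-++; length-++-≤ʳ; length-map; map-id; map-∘; map-cong; map-++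
        ; unfold-reverse; reverse-++; reverse-involutive; reverse-map )
open import Data.List.Relation.Binary.Permutation.Propositional using (↭⇒↭ₛ)
open import Data.List.Relation.Binary.Permutation.Propositional.Properties using (↭-reverse)
import Data.List.Relation.Binary.Pointwise as Pointwise
open import Data.List.Relation.Binary.Pointwise using (Pointwise; []; _∷_; Pointwise-length)
  renaming (++⁺ to infixr 5 _++ᵖ_)
open import Data.List.Relation.Unary.All as All using (All; []; _∷_)
import Data.List.Relation.Unary.All.Properties as Allₚ
open import Data.List.Relation.Unary.Any using (any?)
open import Data.Nat as ℕ using (ℕ; zero; suc; _+_; _∸_; _⊔_; _≤_; _<_; z≤n; s≤s)
open import Data.Nat.Induction using (<-wellFounded)
open import Data.Nat.ListAction using (sum)
open import Data.Nat.ListAction.Properties using (sum-++; sum-↭)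
import Data.Nat.Properties as ℕ
open import Data.Nat.Tactic.RingSolver using () renaming (solve-∀ to ℕ-solve-∀)
open import Data.Product using (_×_; _,_; proj₁; proj₂; ∃-syntax; zip′)
import Data.Product as Product
open import Data.Sum using (_⊎_; inj₁; inj₂; [_,_]′)
open import Data.Unit using (⊤)
open import Function using (_∘_; id)
open import Induction.WellFounded using (Acc; acc)
open import Relation.Binary.PropositionalEquality hiding ([_])
open import Relation.Nullary using (yes; no)

import Data.List.Relation.Binary.Permutation.Setoid.Properties (setoid ℕ) as Perm
open import Algebra.Solver.Monoid (++-monoid ℤ) using (_⊕_; _⊜_) renaming (solve to ++-solve)

map-≡[] : ∀ {A B : Set} {f : A → B} xs → map f xs ≡ [] → xs ≡ []
map-≡[] [] _ = refl

sum-++₃ : ∀ X Y Z → sum (X ++ Y ++ Z) ≡ sum X + (sum Y + sum Z)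
sum-++₃ X Y Z = trans (sum-++ X (Y ++ Z)) (cong (_+_ (sum X)) (sum-++ Y Z))

sum-positive : ∀ {X} → All (0 <_) X → X ≢ [] → 0 < sum X
sum-positive {[]}    _        X≢[] = ⊥-elim (X≢[] refl)
sum-positive {x ∷ X} (x>0 ∷ _) _   = ℕ.<-≤-trans x>0 (ℕ.m≤m+n x (sum X))

maximum : List ℕ → ℕ
maximum = foldr _⊔_ 0

≤-maximum : ∀ B → All (_≤ maximum B) B
≤-maximum []      = []
≤-maximum (b ∷ B) = ℕ.m≤m⊔n b (maximum B) ∷ All.map (λ b′≤ → ℕ.≤-trans b′≤ (ℕ.m≤n⊔m b (maximum B))) (≤-maximum B)

maximum-reverse : ∀ B → maximum (reverse B) ≡ maximum B
maximum-reverse B = Perm.foldr-commMonoid ℕ.⊔-0-isCommutativeMonoid (↭⇒↭ₛ (↭-reverse B))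

reverse-≢[] : ∀ {A : Set} {xs : List A} → xs ≢ [] → reverse xs ≢ []
reverse-≢[] {xs = xs} xs≢[] rev≡[] = xs≢[] (trans (sym (reverse-involutive xs)) (cong reverse rev≡[]))

All-reverse⁺ : ∀ {A : Set} {P : A → Set} {xs} → All P xs → All P (reverse xs)
All-reverse⁺ {xs = []}     []       = []
All-reverse⁺ {P = P} {x ∷ xs} (p ∷ ps) = subst (All P) (sym (unfold-reverse x xs)) (Allₚ.∷ʳ⁺ (All-reverse⁺ ps) p)

prefix-or-extension : ∀ {A : Set} (V₁ : List A) {V₂} W₁ {W₂} → V₁ ++ V₂ ≡ W₁ ++ W₂ →
                      (∃[ Z ] W₁ ≡ V₁ ++ Z) ⊎ (∃[ Z ] V₁ ≡ W₁ ++ Z)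
prefix-or-extension []       W₁       _  = inj₁ (W₁ , refl)
prefix-or-extension (v ∷ V₁) []       _  = inj₂ (v ∷ V₁ , refl)
prefix-or-extension (v ∷ V₁) (w ∷ W₁) eq with refl ← ∷-injectiveˡ eq with prefix-or-extension V₁ W₁ (∷-injectiveʳ eq)
... | inj₁ (Z , W₁≡) = inj₁ (Z , cong (v ∷_) W₁≡)
... | inj₂ (Z , V₁≡) = inj₂ (Z , cong (v ∷_) V₁≡)

-- Walks that stay nonnegative

-- Heights are natural numbers, so a walk never goes below zero.
data Walk : ℕ → List ℤ → ℕ → Set where
  []  : ∀ {h} → Walk h [] h
  _∷_ : ∀ {h h′ h″ x xs} → + h +ℤ x ≡ + h′ → Walk h′ xs h″ → Walk h (x ∷ xs) h″

walk-++ : ∀ {h h′ h″ xs ys} → Walk h xs h′ → Walk h′ ys h″ → Walk h (xs ++ ys) h″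
walk-++ []      w = w
walk-++ (e ∷ v) w = e ∷ walk-++ v w

walk-++⁻ : ∀ {h h″} xs {ys} → Walk h (xs ++ ys) h″ → ∃[ h′ ] Walk h xs h′ × Walk h′ ys h″
walk-++⁻ []       w       = _ , [] , w
walk-++⁻ (x ∷ xs) (e ∷ w) = let h′ , u , v = walk-++⁻ xs w in h′ , e ∷ u , v

walk-sum : ∀ {h xs h′} → Walk h xs h′ → + h +ℤ sumℤ xs ≡ + h′
walk-sum {h} []               = ℤ.+-identityʳ (+ h)
walk-sum {h} {x ∷ xs} (e ∷ w) =
  trans (sym (ℤ.+-assoc (+ h) x (sumℤ xs))) (trans (cong (_+ℤ sumℤ xs) e) (walk-sum w))

walk-prefix : ∀ {h xs h′} → Walk h xs h′ → ∀ q → 0ℤ ℤ.≤ + h +ℤ sumℤ (take q xs)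
walk-prefix w                zero    = +≤+ z≤n
walk-prefix []               (suc q) = +≤+ z≤n
walk-prefix {h} {x ∷ xs} (e ∷ w) (suc q) =
  subst (0ℤ ℤ.≤_) (trans (cong (_+ℤ sumℤ (take q xs)) (sym e)) (ℤ.+-assoc (+ h) x _)) (walk-prefix w q)

walk-of-prefixes : ∀ h xs → (∀ q → 0ℤ ℤ.≤ + h +ℤ sumℤ (take q xs)) → ∃[ h′ ] Walk h xs h′
walk-of-prefixes h []       _       = h , []
walk-of-prefixes h (x ∷ xs) nonneg =
  let h′ , w = walk-of-prefixes ℤ.∣ + h +ℤ x ∣ xs prefixes in h′ , sym step ∷ w
  where
  step : + ℤ.∣ + h +ℤ x ∣ ≡ + h +ℤ x
  step = ℤ.0≤i⇒+∣i∣≡i (subst (λ y → 0ℤ ℤ.≤ + h +ℤ y) (ℤ.+-identityʳ x) (nonneg 1))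
  prefixes : ∀ q → 0ℤ ℤ.≤ + ℤ.∣ + h +ℤ x ∣ +ℤ sumℤ (take q xs)
  prefixes q = subst (0ℤ ℤ.≤_) (trans (sym (ℤ.+-assoc (+ h) x _)) (cong (_+ℤ _) (sym step))) (nonneg (suc q))

catalan⇒walk : ∀ {xs} → GenCatalan xs → Walk 0 xs 0
catalan⇒walk {xs} c =
  let h′ , w = walk-of-prefixes 0 xs (λ q → subst (0ℤ ℤ.≤_) (sym (ℤ.+-identityˡ _)) (prefixNonneg q))
  in subst (Walk 0 xs) (ℤ.+-injective (trans (sym (walk-sum w)) (trans (ℤ.+-identityˡ _) sumZero))) w
  where open GenCatalan c

walk⇒catalan : ∀ {xs} → xs ≢ [] → All (_≢ 0ℤ) xs → Walk 0 xs 0 → GenCatalan xs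
walk⇒catalan ne nz w = record
  { nonempty     = ne
  ; nonzero      = nz
  ; sumZero      = trans (sym (ℤ.+-identityˡ _)) (walk-sum w)
  ; prefixNonneg = λ q → subst (0ℤ ℤ.≤_) (ℤ.+-identityˡ _) (walk-prefix w q)
  }

-- Ascents and descents

ascent : List ℕ → List ℤ
ascent = map (λ a → + a)

descent : List ℕ → List ℤ
descent = map (λ b → - + b)

ascent-++ : ∀ A A′ → ascent (A ++ A′) ≡ ascent A ++ ascent A′
ascent-++ = map-++ _

descent-++ : ∀ B B′ → descent (B ++ B′) ≡ descent B ++ descent B′
descent-++ = map-++ _

sumℤ-ascent : ∀ A → sumℤ (ascent A) ≡ + sum A
sumℤ-ascent []      = refl
sumℤ-ascent (a ∷ A) = cong (+ a +ℤ_) (sumℤ-ascent A)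

sumℤ-descent : ∀ B → sumℤ (descent B) ≡ - + sum B
sumℤ-descent []      = refl
sumℤ-descent (b ∷ B) = trans (cong (- + b +ℤ_) (sumℤ-descent B)) (sym (ℤ.neg-distrib-+ (+ b) (+ sum B)))

+-minus-cancel : ∀ i j → i +ℤ j +ℤ - j ≡ i
+-minus-cancel = solve-∀

minus-+-cancel : ∀ i j → i +ℤ - j +ℤ j ≡ i
minus-+-cancel = solve-∀

ascent-walk : ∀ h A → Walk h (ascent A) (h + sum A)
ascent-walk h []      rewrite ℕ.+-identityʳ h = []
ascent-walk h (a ∷ A) rewrite sym (ℕ.+-assoc h a (sum A)) = refl ∷ ascent-walk (h + a) A

descent-walk : ∀ h B → Walk (h + sum B) (descent B) h
descent-walk h []      rewrite ℕ.+-identityʳ h = []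
descent-walk h (b ∷ B) rewrite ℕ.+-comm b (sum B) | sym (ℕ.+-assoc h (sum B) b) =
  +-minus-cancel (+ (h + sum B)) (+ b) ∷ descent-walk h B

ascent-walk-end : ∀ {h h′} A → Walk h (ascent A) h′ → h′ ≡ h + sum A
ascent-walk-end {h} A w = ℤ.+-injective (sym (trans (cong (+ h +ℤ_) (sym (sumℤ-ascent A))) (walk-sum w)))

descent-walk-end : ∀ {h h′} B → Walk h (descent B) h′ → h ≡ h′ + sum B
descent-walk-end {h} {h′} B w = ℤ.+-injective (begin
  + h                                 ≡⟨ minus-+-cancel (+ h) (+ sum B) ⟨
  + h +ℤ - + sum B +ℤ + sum B         ≡⟨ cong (λ s → + h +ℤ s +ℤ + sum B) (sumℤ-descent B) ⟨
  + h +ℤ sumℤ (descent B) +ℤ + sum B  ≡⟨ cong (_+ℤ + sum B) (walk-sum w) ⟩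
  + (h′ + sum B)                      ∎)
  where open ≡-Reasoning

peak-heights : ∀ {h} A B {rest} → Walk h (ascent A ++ descent B ++ rest) 0 →
               ∃[ h₀ ] h + sum A ≡ h₀ + sum B × Walk h₀ rest 0
peak-heights A B walk =
  let _ , walk-A , walk-B+rest = walk-++⁻ (ascent A) walk
      h₀ , walk-B , walk-rest = walk-++⁻ (descent B) walk-B+rest
  in h₀ , trans (sym (ascent-walk-end A walk-A)) (descent-walk-end B walk-B) , walk-rest

-- Reductions given by masks

split-++ : ∀ bs {cs} xs {ys} → length bs ≡ length xs →
           split (bs ++ cs) (xs ++ ys) ≡ zip′ _++_ _++_ (split bs xs) (split cs ys)
split-++ []           []       _   = refl
split-++ (true  ∷ bs) (x ∷ xs) len = cong (Product.map₁ (x ∷_)) (split-++ bs xs (ℕ.suc-injective len))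
split-++ (false ∷ bs) (x ∷ xs) len = cong (Product.map₂ (x ∷_)) (split-++ bs xs (ℕ.suc-injective len))

reducible-of-split : ∀ bs {xs ys zs} → length bs ≡ length xs → split bs xs ≡ (ys , zs) →
                     GenCatalan ys → GenCatalan zs → Reducible xs
reducible-of-split bs len refl c₁ c₂ = bs , len , c₁ , c₂

select reject : List ℤ → List Bool
select xs = replicate (length xs) true
reject xs = replicate (length xs) false

Fits : List Bool → List ℤ → Set
Fits = Pointwise (λ _ _ → ⊤)

fits-replicate : ∀ b xs → Fits (replicate (length xs) b) xs
fits-replicate b []       = []
fits-replicate b (x ∷ xs) = _ ∷ fits-replicate b xs

length⇒fits : ∀ bs xs → length bs ≡ length xs → Fits bs xs
length⇒fits []       []       _   = []
length⇒fits (b ∷ bs) (x ∷ xs) len = _ ∷ length⇒fits bs xs (ℕ.suc-injective len)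

fits-split : ∀ {bs} L {y R} → Fits bs (L ++ y ∷ R) → ∃[ bL ] ∃[ b ] ∃[ bR ] bs ≡ bL ++ b ∷ bR × Fits bL L × Fits bR R
fits-split []      (_ ∷ f) = [] , _ , _ , refl , [] , f
fits-split (x ∷ L) (_ ∷ f) =
  let bL , b , bR , eq , fL , fR = fits-split L f in _ ∷ bL , b , bR , cong (_ ∷_) eq , _ ∷ fL , fR

split-select-++ : ∀ xs {cs ys} → split (select xs ++ cs) (xs ++ ys) ≡ Product.map₁ (xs ++_) (split cs ys)
split-select-++ []       = refl
split-select-++ (x ∷ xs) = cong (Product.map₁ (x ∷_)) (split-select-++ xs)

split-reject-++ : ∀ xs {cs ys} → split (reject xs ++ cs) (xs ++ ys) ≡ Product.map₂ (xs ++_) (split cs ys)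
split-reject-++ []       = refl
split-reject-++ (x ∷ xs) = cong (Product.map₂ (x ∷_)) (split-reject-++ xs)

split-reject : ∀ xs → split (reject xs) xs ≡ ([] , xs)
split-reject []       = refl
split-reject (x ∷ xs) = cong (Product.map₂ (x ∷_)) (split-reject xs)

reducible-by-excision : ∀ L P M N R → All (_≢ 0ℤ) (L ++ P ++ M ++ N ++ R) → P ≢ [] → L ++ M ++ R ≢ [] →
                        Walk 0 (P ++ N) 0 → Walk 0 (L ++ M ++ R) 0 → Reducible (L ++ P ++ M ++ N ++ R)
reducible-by-excision L P M N R nz P≢[] rest≢[] wPN wLMR =
  reducible-of-split mask fits splits
    (walk⇒catalan (P≢[] ∘ ++-conicalˡ P N) (Allₚ.++⁺ nzP nzN) wPN)
    (walk⇒catalan rest≢[] (Allₚ.++⁺ nzL (Allₚ.++⁺ nzM nzR)) wLMR)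
  where
  mask = reject L ++ select P ++ reject M ++ select N ++ reject R
  fits : length mask ≡ length (L ++ P ++ M ++ N ++ R)
  fits = Pointwise-length (fits-replicate false L ++ᵖ fits-replicate true P ++ᵖ fits-replicate false M
           ++ᵖ fits-replicate true N ++ᵖ fits-replicate false R)
  splits : split mask (L ++ P ++ M ++ N ++ R) ≡ (P ++ N , L ++ M ++ R)
  splits = begin
    split mask (L ++ P ++ M ++ N ++ R)
      ≡⟨ split-reject-++ L ⟩
    Product.map₂ (L ++_) (split (select P ++ reject M ++ select N ++ reject R) (P ++ M ++ N ++ R))
      ≡⟨ cong (Product.map₂ (L ++_)) (split-select-++ P) ⟩
    Product.map₂ (L ++_) (Product.map₁ (P ++_) (split (reject M ++ select N ++ reject R) (M ++ N ++ R)))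
      ≡⟨ cong (Product.map₂ (L ++_) ∘ Product.map₁ (P ++_)) (split-reject-++ M) ⟩
    (P ++ proj₁ (split (select N ++ reject R) (N ++ R)) , L ++ M ++ proj₂ (split (select N ++ reject R) (N ++ R)))
      ≡⟨ cong (λ s → (P ++ proj₁ s , L ++ M ++ proj₂ s)) (split-select-++ N) ⟩
    (P ++ N ++ proj₁ (split (reject R) R) , L ++ M ++ proj₂ (split (reject R) R))
      ≡⟨ cong (λ s → (P ++ N ++ proj₁ s , L ++ M ++ proj₂ s)) (split-reject R) ⟩
    (P ++ N ++ [] , L ++ M ++ R)
      ≡⟨ cong (λ s → (P ++ s , L ++ M ++ R)) (++-identityʳ N) ⟩
    (P ++ N , L ++ M ++ R) ∎
    where open ≡-Reasoning
  nzL = Allₚ.++⁻ˡ L nz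
  nzP = Allₚ.++⁻ˡ P (Allₚ.++⁻ʳ L nz)
  nzM = Allₚ.++⁻ˡ M (Allₚ.++⁻ʳ P (Allₚ.++⁻ʳ L nz))
  nzN = Allₚ.++⁻ˡ N (Allₚ.++⁻ʳ M (Allₚ.++⁻ʳ P (Allₚ.++⁻ʳ L nz)))
  nzR = Allₚ.++⁻ʳ N (Allₚ.++⁻ʳ M (Allₚ.++⁻ʳ P (Allₚ.++⁻ʳ L nz)))

walk-substitute : ∀ X {Z w seg} → (∀ h → Walk h seg (h + w)) → Walk 0 (X ++ + w ∷ Z) 0 → Walk 0 (X ++ seg ++ Z) 0
walk-substitute X seg-walk walk with walk-++⁻ X walk
... | h , before , step ∷ after = walk-++ before (walk-++ (subst (Walk h _) (ℤ.+-injective step) (seg-walk h)) after)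

catalan-substitute : ∀ X {Z w seg} → seg ≢ [] → All (_≢ 0ℤ) seg → (∀ h → Walk h seg (h + w)) →
                     GenCatalan (X ++ + w ∷ Z) → GenCatalan (X ++ seg ++ Z)
catalan-substitute X {Z} {seg = seg} seg≢[] nz-seg seg-walk c =
  walk⇒catalan (seg≢[] ∘ ++-conicalˡ seg Z ∘ ++-conicalʳ X (seg ++ Z))
    (Allₚ.++⁺ (Allₚ.++⁻ˡ X nz) (Allₚ.++⁺ nz-seg (All.tail (Allₚ.++⁻ʳ X nz))))
    (walk-substitute X seg-walk (catalan⇒walk c))
  where open GenCatalan c renaming (nonzero to nz)

reducible-by-expansion : ∀ L seg R w → seg ≢ [] → All (_≢ 0ℤ) seg → (∀ h → Walk h seg (h + w)) →
                         Reducible (L ++ + w ∷ R) → Reducible (L ++ seg ++ R)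
reducible-by-expansion L seg R w seg≢[] nz-seg seg-walk (bs , len , c₁ , c₂)
  with fits-split L (length⇒fits bs _ len)
... | bL , true , bR , refl , fL , fR =
  reducible-of-split (bL ++ select seg ++ bR) (Pointwise-length (fL ++ᵖ fits-replicate true seg ++ᵖ fR))
    (trans (split-++ bL L (Pointwise-length fL)) (cong (zip′ _++_ _++_ (split bL L)) (split-select-++ seg)))
    (catalan-substitute (sublist bL L) seg≢[] nz-seg seg-walk (subst GenCatalan (cong proj₁ old) c₁))
    (subst GenCatalan (cong proj₂ old) c₂)
  where old = split-++ bL L {ys = + w ∷ R} (Pointwise-length fL)
... | bL , false , bR , refl , fL , fR =
  reducible-of-split (bL ++ reject seg ++ bR) (Pointwise-length (fL ++ᵖ fits-replicate false seg ++ᵖ fR))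
    (trans (split-++ bL L (Pointwise-length fL)) (cong (zip′ _++_ _++_ (split bL L)) (split-reject-++ seg)))
    (subst GenCatalan (cong proj₁ old) c₁)
    (catalan-substitute (complement bL L) seg≢[] nz-seg seg-walk (subst GenCatalan (cong proj₂ old) c₂))
  where old = split-++ bL L {ys = + w ∷ R} (Pointwise-length fL)

-- Mirror images

mirror : List ℤ → List ℤ
mirror xs = reverse (map -_ xs)

mirror-∷ : ∀ x xs → mirror (x ∷ xs) ≡ mirror xs ++ [ - x ]
mirror-∷ x xs = unfold-reverse (- x) (map -_ xs)

mirror-++ : ∀ xs ys → mirror (xs ++ ys) ≡ mirror ys ++ mirror xs
mirror-++ xs ys = trans (cong reverse (map-++ -_ xs ys)) (reverse-++ (map -_ xs) (map -_ ys))

mirror-involutive : ∀ xs → mirror (mirror xs) ≡ xs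
mirror-involutive xs = begin
  reverse (map -_ (reverse (map -_ xs)))   ≡⟨ cong reverse (reverse-map -_ (map -_ xs)) ⟩
  reverse (reverse (map -_ (map -_ xs)))   ≡⟨ reverse-involutive _ ⟩
  map -_ (map -_ xs)                       ≡⟨ map-∘ xs ⟨
  map (-_ ∘ -_) xs                         ≡⟨ map-cong ℤ.neg-involutive xs ⟩
  map id xs                                ≡⟨ map-id xs ⟩
  xs                                       ∎
  where open ≡-Reasoning

mirror-≢[] : ∀ {xs} → xs ≢ [] → mirror xs ≢ []
mirror-≢[] {[]}     xs≢[] = ⊥-elim (xs≢[] refl)
mirror-≢[] {x ∷ xs} _ eq  with ++-conicalʳ (mirror xs) [ - x ] (trans (sym (mirror-∷ x xs)) eq)
... | ()

mirror-nonzero : ∀ {xs} → All (_≢ 0ℤ) xs → All (_≢ 0ℤ) (mirror xs)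
mirror-nonzero nz = All-reverse⁺ (Allₚ.map⁺ (All.map (_∘ ℤ.neg-injective) nz))

mirror-ascent : ∀ A → mirror (ascent A) ≡ descent (reverse A)
mirror-ascent A = trans (cong reverse (sym (map-∘ A))) (sym (reverse-map _ A))

mirror-descent : ∀ B → mirror (descent B) ≡ ascent (reverse B)
mirror-descent B =
  trans (cong reverse (trans (sym (map-∘ B)) (map-cong (ℤ.neg-involutive ∘ +_) B))) (sym (reverse-map _ B))

walk-mirror : ∀ {h xs h′} → Walk h xs h′ → Walk h′ (mirror xs) h
walk-mirror []                        = []
walk-mirror {h} {x ∷ xs} (step ∷ walk) =
  subst (λ ys → Walk _ ys h) (sym (mirror-∷ x xs))
    (walk-++ (walk-mirror walk) (trans (cong (_+ℤ - x) (sym step)) (+-minus-cancel (+ h) x) ∷ []))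

catalan-mirror : ∀ {xs} → GenCatalan xs → GenCatalan (mirror xs)
catalan-mirror c = walk⇒catalan (mirror-≢[] nonempty) (mirror-nonzero nonzero) (walk-mirror (catalan⇒walk c))
  where open GenCatalan c

split-map : ∀ (f : ℤ → ℤ) bs xs → split bs (map f xs) ≡ Product.map (map f) (map f) (split bs xs)
split-map f []           xs       = refl
split-map f (true  ∷ bs) []       = refl
split-map f (false ∷ bs) []       = refl
split-map f (true  ∷ bs) (x ∷ xs) = cong (Product.map₁ (f x ∷_)) (split-map f bs xs)
split-map f (false ∷ bs) (x ∷ xs) = cong (Product.map₂ (f x ∷_)) (split-map f bs xs)

split-reverse : ∀ {bs xs} → Fits bs xs → split (reverse bs) (reverse xs) ≡ Product.map reverse reverse (split bs xs)
split-reverse []                        = refl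
split-reverse {b ∷ bs} {x ∷ xs} (_ ∷ f) = begin
  split (reverse (b ∷ bs)) (reverse (x ∷ xs))
    ≡⟨ cong₂ split (unfold-reverse b bs) (unfold-reverse x xs) ⟩
  split (reverse bs ++ [ b ]) (reverse xs ++ [ x ])
    ≡⟨ split-++ (reverse bs) (reverse xs) (Pointwise-length (Pointwise.reverse⁺ f)) ⟩
  zip′ _++_ _++_ (split (reverse bs) (reverse xs)) (split [ b ] [ x ])
    ≡⟨ cong (λ s → zip′ _++_ _++_ s (split [ b ] [ x ])) (split-reverse f) ⟩
  zip′ _++_ _++_ (Product.map reverse reverse (split bs xs)) (split [ b ] [ x ])
    ≡⟨ last b ⟩
  Product.map reverse reverse (split (b ∷ bs) (x ∷ xs)) ∎
  where
  open ≡-Reasoning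
  last : ∀ b → zip′ _++_ _++_ (Product.map reverse reverse (split bs xs)) (split [ b ] [ x ])
             ≡ Product.map reverse reverse (split (b ∷ bs) (x ∷ xs))
  last true  = cong₂ _,_ (sym (unfold-reverse x (sublist bs xs))) (++-identityʳ (reverse (complement bs xs)))
  last false = cong₂ _,_ (++-identityʳ (reverse (sublist bs xs))) (sym (unfold-reverse x (complement bs xs)))

reducible-mirror : ∀ {xs} → Reducible xs → Reducible (mirror xs)
reducible-mirror {xs} (bs , len , c₁ , c₂) =
  reducible-of-split (reverse bs) fits′ splits (catalan-mirror c₁) (catalan-mirror c₂)
  where
  fits : Fits bs (map -_ xs)
  fits = length⇒fits bs _ (trans len (sym (length-map -_ xs)))
  fits′ : length (reverse bs) ≡ length (mirror xs)
  fits′ = Pointwise-length (Pointwise.reverse⁺ fits)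
  splits : split (reverse bs) (mirror xs) ≡ (mirror (sublist bs xs) , mirror (complement bs xs))
  splits = trans (split-reverse fits) (cong (Product.map reverse reverse) (split-map -_ bs xs))

-- Pigeonhole principle

record Repeat {A : Set} (f : A → ℕ) (L : List A) : Set where
  constructor repeat
  field
    before between after : List A
    first second          : A
    splits                : L ≡ before ++ first ∷ between ++ second ∷ after
    same-value            : f first ≡ f second

-- The order-preserving bijection ℕ ∖ {k} → ℕ.
squeeze : ℕ → ℕ → ℕ
squeeze zero    m       = ℕ.pred m
squeeze (suc k) zero    = zero
squeeze (suc k) (suc m) = suc (squeeze k m)

squeeze-< : ∀ {k m b} → m ≢ k → m < suc b → k < suc b → squeeze k m < b
squeeze-< {zero}  {zero}  m≢k _         _         = ⊥-elim (m≢k refl)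
squeeze-< {zero}  {suc m} _   (s≤s m<b) _         = m<b
squeeze-< {suc k} {zero}  {suc b} _ _   _         = s≤s z≤n
squeeze-< {suc k} {zero}  {zero}  _ _   (s≤s ())
squeeze-< {suc k} {suc m} {zero}  _ (s≤s ()) _
squeeze-< {suc k} {suc m} {suc b} m≢k (s≤s m<b) (s≤s k<b) = s≤s (squeeze-< (m≢k ∘ cong suc) m<b k<b)

squeeze-injective : ∀ {k m m′} → m ≢ k → m′ ≢ k → squeeze k m ≡ squeeze k m′ → m ≡ m′
squeeze-injective {zero}  {zero}           m≢k _    _  = ⊥-elim (m≢k refl)
squeeze-injective {zero}  {suc m} {zero}   _   m′≢k _  = ⊥-elim (m′≢k refl)
squeeze-injective {zero}  {suc m} {suc m′} _   _    eq = cong suc eq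
squeeze-injective {suc k} {zero}  {zero}   _   _    _  = refl
squeeze-injective {suc k} {suc m} {suc m′} m≢k m′≢k eq =
  cong suc (squeeze-injective (m≢k ∘ cong suc) (m′≢k ∘ cong suc) (ℕ.suc-injective eq))

All-repeat : ∀ {A : Set} {P : A → Set} B {a M a′ N} → All P (B ++ a ∷ M ++ a′ ∷ N) → P a × P a′
All-repeat B {M = M} ps = All.head (Allₚ.++⁻ʳ B ps) , All.head (Allₚ.++⁻ʳ M (All.tail (Allₚ.++⁻ʳ B ps)))

-- Either f t recurs further on, or squeezing the value f t out leaves fewer values for the rest.
pigeonhole : ∀ {A : Set} (f : A → ℕ) {b} L → b < length L → All (λ v → f v < b) L → Repeat f L
pigeonhole f {zero}  (t ∷ L) _           (ft<0 ∷ _)     = ⊥-elim (ℕ.n≮0 ft<0)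
pigeonhole f {suc b} (t ∷ L) (s≤s b<|L|) (ft<b ∷ fL<b) with any? (λ v → f v ℕ.≟ f t) L
... | yes hit =
  let v , v∈L , fv≡ft = find hit ; L₁ , L₂ , L≡ = ∈-∃++ v∈L in repeat [] L₁ L₂ t v (cong (t ∷_) L≡) (sym fv≡ft)
... | no miss = lift (pigeonhole (squeeze (f t) ∘ f) L b<|L| (All.zipWith squeezed (fL<b , avoid)))
  where
  avoid : All (λ v → f v ≢ f t) L
  avoid = Allₚ.¬Any⇒All¬ L miss
  squeezed : ∀ {v} → f v < suc b × f v ≢ f t → squeeze (f t) (f v) < b
  squeezed (fv<b , fv≢ft) = squeeze-< fv≢ft fv<b ft<b
  lift : Repeat (squeeze (f t) ∘ f) L → Repeat f (t ∷ L)
  lift (repeat B M N a a′ refl eq) =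
    let a≢ , a′≢ = All-repeat B avoid in repeat (t ∷ B) M N a a′ refl (squeeze-injective a≢ a′≢ eq)

-- Segments of equal sum in an ascent and a descent

stepStarts : ℕ → List ℕ → List ℕ
stepStarts g []      = []
stepStarts g (t ∷ T) = g ∷ stepStarts (g + t) T

length-stepStarts : ∀ g T → length (stepStarts g T) ≡ length T
length-stepStarts g []      = refl
length-stepStarts g (t ∷ T) = cong suc (length-stepStarts (g + t) T)

stepStarts-bounds : ∀ g {T} → All (0 <_) T → All (λ τ → g ≤ τ × τ < g + sum T) (stepStarts g T)
stepStarts-bounds g {[]}    []          = []
stepStarts-bounds g {t ∷ T} (t>0 ∷ T⁺) =
  (ℕ.≤-refl , ℕ.m<m+n g (ℕ.<-≤-trans t>0 (ℕ.m≤m+n t (sum T))))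
  ∷ All.map (λ {τ} (g+t≤τ , τ<) → ℕ.≤-trans (ℕ.m≤m+n g t) g+t≤τ , subst (τ <_) (ℕ.+-assoc g t (sum T)) τ<)
            (stepStarts-bounds (g + t) T⁺)

stepStarts-split : ∀ g T B {a R} → stepStarts g T ≡ B ++ a ∷ R →
                   ∃[ Tₗ ] ∃[ Tᵣ ] T ≡ Tₗ ++ Tᵣ × g + sum Tₗ ≡ a × stepStarts a Tᵣ ≡ a ∷ R
stepStarts-split g []      []      ()
stepStarts-split g []      (_ ∷ _) ()
stepStarts-split g (t ∷ T) []      refl = [] , t ∷ T , refl , ℕ.+-identityʳ g , refl
stepStarts-split g (t ∷ T) (_ ∷ B) eq   =
  let Tₗ , Tᵣ , T≡ , at-a , starts = stepStarts-split (g + t) T B (∷-injectiveʳ eq)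
  in t ∷ Tₗ , Tᵣ , cong (t ∷_) T≡ , trans (sym (ℕ.+-assoc g t (sum Tₗ))) at-a , starts

stepStarts-segment : ∀ g T B {a M a′ N} → stepStarts g T ≡ B ++ a ∷ M ++ a′ ∷ N →
                     ∃[ T₁ ] ∃[ P ] ∃[ T₂ ] T ≡ T₁ ++ P ++ T₂ × a + sum P ≡ a′ × P ≢ [] × T₂ ≢ []
stepStarts-segment g T B starts≡ with stepStarts-split g T B starts≡
... | T₁ , t ∷ Tᵣ , refl , _ , starts-a with stepStarts-split (_ + t) Tᵣ _ (∷-injectiveʳ starts-a)
...   | Tₘ , t′ ∷ T₂ , refl , at-a′ , _ =
  T₁ , t ∷ Tₘ , t′ ∷ T₂ , refl , trans (sym (ℕ.+-assoc _ t (sum Tₘ))) at-a′ , (λ ()) , (λ ())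

levelAbove : ℕ → ℕ → List ℕ → ℕ
levelAbove τ c []      = c
levelAbove τ c (u ∷ U) with τ ℕ.<? c + u
... | yes _ = c + u
... | no  _ = levelAbove τ (c + u) U

record LevelAbove (τ c m : ℕ) (U : List ℕ) (ℓ : ℕ) : Set where
  field
    prefix suffix : List ℕ
    U-splits      : U ≡ prefix ++ suffix
    at-prefix     : c + sum prefix ≡ ℓ
    above         : τ < ℓ
    close         : ℓ ≤ τ + m

levelAbove-spec : ∀ {τ c m} U → c ≤ τ → τ < c + sum U → All (_≤ m) U → LevelAbove τ c m U (levelAbove τ c U)
levelAbove-spec {τ} {c} []      c≤τ τ<c _ = ⊥-elim (ℕ.<⇒≱ τ<c (subst (_≤ τ) (sym (ℕ.+-identityʳ c)) c≤τ))
levelAbove-spec {τ} {c} {m} (u ∷ U) c≤τ τ<top (u≤m ∷ U≤m) with τ ℕ.<? c + u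
... | yes τ<c+u = record
  { prefix = [ u ] ; suffix = U ; U-splits = refl ; at-prefix = cong (_+_ c) (ℕ.+-identityʳ u)
  ; above = τ<c+u ; close = ℕ.+-mono-≤ c≤τ u≤m }
... | no  τ≮c+u =
  let open LevelAbove (levelAbove-spec U (ℕ.≮⇒≥ τ≮c+u) (subst (τ <_) (sym (ℕ.+-assoc c u (sum U))) τ<top) U≤m)
  in record
  { prefix = u ∷ prefix ; suffix = suffix ; U-splits = cong (u ∷_) U-splits
  ; at-prefix = trans (sym (ℕ.+-assoc c u (sum prefix))) at-prefix ; above = above ; close = close }

gap-bound : ∀ {τ ℓ m} → τ < ℓ → ℓ ≤ τ + m → ℓ ∸ suc τ < m
gap-bound {τ} {ℓ} {m} τ<ℓ ℓ≤τ+m = ℕ.+-cancelˡ-< τ (ℓ ∸ suc τ) m (subst (_≤ τ + m) (sym (ℕ.m+[n∸m]≡n τ<ℓ)) ℓ≤τ+m)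

equal-gaps : ∀ {a ℓ a′ ℓ′ s} → a < ℓ → a′ < ℓ′ → a + s ≡ a′ → ℓ ∸ suc a ≡ ℓ′ ∸ suc a′ → ℓ + s ≡ ℓ′
equal-gaps {a} {ℓ} {a′} {ℓ′} {s} a<ℓ a′<ℓ′ a+s≡a′ gaps = begin
  ℓ + s                        ≡⟨ cong (_+ s) (ℕ.m+[n∸m]≡n a<ℓ) ⟨
  suc a + (ℓ ∸ suc a) + s      ≡⟨ shuffle a (ℓ ∸ suc a) s ⟩
  suc (a + s) + (ℓ ∸ suc a)    ≡⟨ cong₂ (λ x d → suc x + d) a+s≡a′ gaps ⟩
  suc a′ + (ℓ′ ∸ suc a′)       ≡⟨ ℕ.m+[n∸m]≡n a′<ℓ′ ⟩
  ℓ′                           ∎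
  where
  open ≡-Reasoning
  shuffle : ∀ a d s → suc a + d + s ≡ suc (a + s) + d
  shuffle = ℕ-solve-∀

segment-between-levels : ∀ {c s} U {V₁ V₂ W₁ W₂} → U ≡ V₁ ++ V₂ → U ≡ W₁ ++ W₂ →
                         c + sum V₁ + s ≡ c + sum W₁ → 0 < s → ∃[ Z ] U ≡ V₁ ++ Z ++ W₂ × sum Z ≡ s
segment-between-levels {c} {s} U {V₁} {W₁ = W₁} {W₂} refl U≡W levels s>0
  with prefix-or-extension V₁ W₁ U≡W
... | inj₁ (Z , refl) = Z , trans U≡W (++-assoc V₁ Z W₂) , sym (ℕ.+-cancelˡ-≡ (c + sum V₁) s (sum Z) (begin
  c + sum V₁ + s             ≡⟨ levels ⟩
  c + sum (V₁ ++ Z)          ≡⟨ cong (_+_ c) (sum-++ V₁ Z) ⟩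
  c + (sum V₁ + sum Z)       ≡⟨ ℕ.+-assoc c (sum V₁) (sum Z) ⟨
  c + sum V₁ + sum Z         ∎))
  where open ≡-Reasoning
... | inj₂ (Z , refl) = ⊥-elim (ℕ.<⇒≢ s>0 (sym (ℕ.m+n≡0⇒n≡0 (sum Z) (ℕ.+-cancelˡ-≡ (c + sum W₁) _ 0 (begin
  c + sum W₁ + (sum Z + s)   ≡⟨ ℕ.+-assoc (c + sum W₁) (sum Z) s ⟨
  c + sum W₁ + sum Z + s     ≡⟨ cong (λ x → x + s) (ℕ.+-assoc c (sum W₁) (sum Z)) ⟩
  c + (sum W₁ + sum Z) + s   ≡⟨ cong (λ x → c + x + s) (sum-++ W₁ Z) ⟨
  c + sum (W₁ ++ Z) + s      ≡⟨ levels ⟩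
  c + sum W₁                 ≡⟨ ℕ.+-identityʳ _ ⟨
  c + sum W₁ + 0             ∎)))))
  where open ≡-Reasoning

record EqualSumSegments (T U : List ℕ) : Set where
  constructor segments
  field
    T₁ P T₂ U₁ Z U₂ : List ℕ
    T-splits        : T ≡ T₁ ++ P ++ T₂
    U-splits        : U ≡ U₁ ++ Z ++ U₂
    P≢[]            : P ≢ []
    T₂≢[]           : T₂ ≢ []
    equal-sums      : sum P ≡ sum Z

-- Each step start τ of the ascent T has a first level of U above it, at most m higher; with more
-- step starts than possible gaps, two starts a < a′ share their gap, so the segment of T between
-- a and a′ rises exactly as much as the segment of U between the two levels.
equal-sum-segments : ∀ {g h m} T U → All (0 <_) T → All (_≤ m) U → h ≤ g → g + sum T ≡ h + sum U →
                     m < length T → EqualSumSegments T U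
equal-sum-segments {g} {h} {m} T U T⁺ U≤m h≤g tops m<|T| =
  from-repeat (pigeonhole gap (stepStarts g T) (subst (m <_) (sym (length-stepStarts g T)) m<|T|)
                          (All.map (λ s → gap-bound (LevelAbove.above s) (LevelAbove.close s)) specs))
  where
  gap : ℕ → ℕ
  gap τ = levelAbove τ h U ∸ suc τ
  specs : All (λ τ → LevelAbove τ h m U (levelAbove τ h U)) (stepStarts g T)
  specs = All.map (λ {τ} (g≤τ , τ<top) → levelAbove-spec U (ℕ.≤-trans h≤g g≤τ) (subst (τ <_) tops τ<top) U≤m)
                  (stepStarts-bounds g T⁺)
  from-repeat : Repeat gap (stepStarts g T) → EqualSumSegments T U
  from-repeat (repeat B M N a a′ starts≡ same-gap) =
    let T₁ , P , T₂ , T≡ , a+P≡a′ , P≢[] , T₂≢[] = stepStarts-segment g T B starts≡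
        sa , sa′ = All-repeat B (subst (All _) starts≡ specs)
        P⁺ = Allₚ.++⁻ˡ P (Allₚ.++⁻ʳ T₁ (subst (All (0 <_)) T≡ T⁺))
        levels = trans (cong (_+ sum P) (at-prefix sa))
                   (trans (equal-gaps (above sa) (above sa′) a+P≡a′ same-gap) (sym (at-prefix sa′)))
        Z , U≡ , sum-Z = segment-between-levels U {prefix sa} {suffix sa} {prefix sa′} {suffix sa′}
                           (U-splits sa) (U-splits sa′) levels (sum-positive P⁺ P≢[])
    in segments T₁ P T₂ (prefix sa) Z (suffix sa′) T≡ U≡ P≢[] T₂≢[] (sym sum-Z)
    where open LevelAbove

EqualSumSegments-reverse : ∀ {T} B → EqualSumSegments T (reverse B) → EqualSumSegments T B
EqualSumSegments-reverse B (segments T₁ P T₂ U₁ Z U₂ T≡ U≡ P≢[] T₂≢[] sums) =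
  segments T₁ P T₂ (reverse U₂) (reverse Z) (reverse U₁) T≡ B≡ P≢[] T₂≢[] (trans sums (sym (sum-↭ (↭-reverse Z))))
  where
  B≡ : B ≡ reverse U₂ ++ reverse Z ++ reverse U₁
  B≡ = begin
    B                                      ≡⟨ reverse-involutive B ⟨
    reverse (reverse B)                    ≡⟨ cong reverse U≡ ⟩
    reverse (U₁ ++ Z ++ U₂)                ≡⟨ reverse-++ U₁ (Z ++ U₂) ⟩
    reverse (Z ++ U₂) ++ reverse U₁        ≡⟨ cong (_++ reverse U₁) (reverse-++ Z U₂) ⟩
    (reverse U₂ ++ reverse Z) ++ reverse U₁ ≡⟨ ++-assoc (reverse U₂) (reverse Z) (reverse U₁) ⟩
    reverse U₂ ++ reverse Z ++ reverse U₁  ∎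
    where open ≡-Reasoning

-- Reducing at the first peak

heights-after-excision : ∀ g t₁ p t₂ h b₂ q b₁ → g + (t₁ + (p + t₂)) ≡ h + (b₂ + (q + b₁)) → p ≡ q →
                         g + t₁ + t₂ ≡ h + b₁ + b₂
heights-after-excision g t₁ p t₂ h b₂ q b₁ tops refl =
  ℕ.+-cancelʳ-≡ p _ _ (trans (lhs g t₁ p t₂) (trans tops (rhs h b₂ p b₁)))
  where
  lhs : ∀ g t₁ p t₂ → g + t₁ + t₂ + p ≡ g + (t₁ + (p + t₂))
  lhs = ℕ-solve-∀
  rhs : ∀ h b₂ p b₁ → h + (b₂ + (p + b₁)) ≡ h + b₁ + b₂ + p
  rhs = ℕ-solve-∀

-- Removing the matched segments P (from the ascent) and N (from the descent) lowers the whole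
-- stretch between them by the same amount, so what remains still ascends and then descends.
reducible-by-matched-segments : ∀ {g h₀} Lp T B rest → Walk 0 Lp g → Walk h₀ rest 0 → g + sum T ≡ h₀ + sum B →
                                EqualSumSegments T B → All (_≢ 0ℤ) (Lp ++ ascent T ++ descent B ++ rest) →
                                Reducible (Lp ++ ascent T ++ descent B ++ rest)
reducible-by-matched-segments {g} {h₀} Lp T B rest walk-Lp walk-rest tops
  (segments T₁ P T₂ B₂ N B₁ refl refl P≢[] T₂≢[] sums) nz =
  subst Reducible (sym rearranged)
    (reducible-by-excision L (ascent P) M (descent N) R (subst (All _) rearranged nz) (P≢[] ∘ map-≡[] P) kept≢[]
      (walk-++ (ascent-walk 0 P) (subst (λ s → Walk s (descent N) 0) (sym sums) (descent-walk 0 N)))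
      (walk-++ (walk-++ walk-Lp (ascent-walk g T₁))
        (walk-++ (walk-++ (ascent-walk (g + sum T₁) T₂)
                   (subst (λ s → Walk s (descent B₂) (h₀ + sum B₁)) (sym top′) (descent-walk (h₀ + sum B₁) B₂)))
          (walk-++ (descent-walk h₀ B₁) walk-rest))))
  where
  L = Lp ++ ascent T₁
  M = ascent T₂ ++ descent B₂
  R = descent B₁ ++ rest
  rearranged : Lp ++ ascent (T₁ ++ P ++ T₂) ++ descent (B₂ ++ N ++ B₁) ++ rest ≡ L ++ ascent P ++ M ++ descent N ++ R
  rearranged = begin
    Lp ++ ascent (T₁ ++ P ++ T₂) ++ descent (B₂ ++ N ++ B₁) ++ rest
      ≡⟨ cong₂ (λ a d → Lp ++ a ++ d ++ rest)
           (trans (ascent-++ T₁ (P ++ T₂)) (cong (ascent T₁ ++_) (ascent-++ P T₂)))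
           (trans (descent-++ B₂ (N ++ B₁)) (cong (descent B₂ ++_) (descent-++ N B₁))) ⟩
    Lp ++ (ascent T₁ ++ ascent P ++ ascent T₂) ++ (descent B₂ ++ descent N ++ descent B₁) ++ rest
      ≡⟨ ++-solve 8 (λ l t₁ p t₂ b₂ n b₁ r → l ⊕ ((t₁ ⊕ (p ⊕ t₂)) ⊕ ((b₂ ⊕ (n ⊕ b₁)) ⊕ r))
                                      ⊜ (l ⊕ t₁) ⊕ (p ⊕ ((t₂ ⊕ b₂) ⊕ (n ⊕ (b₁ ⊕ r))))) refl
           Lp (ascent T₁) (ascent P) (ascent T₂) (descent B₂) (descent N) (descent B₁) rest ⟩
    L ++ ascent P ++ M ++ descent N ++ R ∎
    where open ≡-Reasoning
  top′ : g + sum T₁ + sum T₂ ≡ h₀ + sum B₁ + sum B₂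
  top′ = heights-after-excision g (sum T₁) (sum P) (sum T₂) h₀ (sum B₂) (sum N) (sum B₁)
           (subst₂ (λ t b → g + t ≡ h₀ + b) (sum-++₃ T₁ P T₂) (sum-++₃ B₂ N B₁) tops) sums
  kept≢[] : L ++ M ++ R ≢ []
  kept≢[] = T₂≢[] ∘ map-≡[] T₂ ∘ ++-conicalˡ (ascent T₂) (descent B₂) ∘ ++-conicalˡ M R ∘ ++-conicalʳ L (M ++ R)

reducible-at-wide-peak : ∀ {g h₀} Lp T B rest → Walk 0 Lp g → Walk h₀ rest 0 → All (0 <_) T → h₀ ≤ g →
                         g + sum T ≡ h₀ + sum B → maximum B < length T →
                         All (_≢ 0ℤ) (Lp ++ ascent T ++ descent B ++ rest) →
                         Reducible (Lp ++ ascent T ++ descent B ++ rest)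
reducible-at-wide-peak Lp T B rest walk-Lp walk-rest T⁺ h₀≤g tops max<|T| =
  reducible-by-matched-segments Lp T B rest walk-Lp walk-rest tops
    (EqualSumSegments-reverse B (equal-sum-segments T (reverse B) T⁺ (All-reverse⁺ (≤-maximum B)) h₀≤g
       (trans tops (cong (_+_ _) (sym (sum-↭ (↭-reverse B))))) max<|T|))

reducible-by-peak-excision : ∀ {h₀} A T B rest → sum A ≡ h₀ → Walk h₀ rest 0 → sum T ≡ sum B → T ≢ [] →
                             ascent A ++ rest ≢ [] → All (_≢ 0ℤ) (ascent A ++ ascent T ++ descent B ++ rest) →
                             Reducible (ascent A ++ ascent T ++ descent B ++ rest)
reducible-by-peak-excision A T B rest sum-A walk-rest T≡B T≢[] kept≢[] nz =
  reducible-by-excision (ascent A) (ascent T) [] (descent B) rest nz (T≢[] ∘ map-≡[] T) kept≢[]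
    (walk-++ (ascent-walk 0 T) (subst (λ s → Walk s (descent B) 0) (sym T≡B) (descent-walk 0 B)))
    (walk-++ (subst (Walk 0 (ascent A)) sum-A (ascent-walk 0 A)) walk-rest)

data Crossing (c h : ℕ) : List ℕ → Set where
  at-step-start : ∀ A T → c + sum A ≡ h → T ≢ [] → Crossing c h (A ++ T)
  inside-step   : ∀ A a T → c + sum A < h → h < c + sum A + a → Crossing c h (A ++ a ∷ T)

crossing : ∀ {c h} A → c ≤ h → h < c + sum A → Crossing c h A
crossing {c} {h} []      c≤h h<c = ⊥-elim (ℕ.<⇒≱ h<c (subst (_≤ h) (sym (ℕ.+-identityʳ c)) c≤h))
crossing {c} {h} (a ∷ A) c≤h h<top with c ℕ.≟ h | h ℕ.<? c + a
... | yes refl | _     = at-step-start [] (a ∷ A) (ℕ.+-identityʳ c) (λ ())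
... | no c≢h   | yes h<c+a =
  inside-step [] a A (subst (_< h) (sym (ℕ.+-identityʳ c)) (ℕ.≤∧≢⇒< c≤h c≢h))
    (subst (λ c′ → h < c′ + a) (sym (ℕ.+-identityʳ c)) h<c+a)
... | no _     | no h≮c+a with crossing A (ℕ.≮⇒≥ h≮c+a) (subst (h <_) (sym (ℕ.+-assoc c a (sum A))) h<top)
...   | at-step-start A′ T at-h T≢[] = at-step-start (a ∷ A′) T (trans (sym (ℕ.+-assoc c a (sum A′))) at-h) T≢[]
...   | inside-step A′ a′ T below above =
  inside-step (a ∷ A′) a′ T (subst (_< h) (ℕ.+-assoc c a (sum A′)) below)
    (subst (λ c′ → h < c′ + a′) (ℕ.+-assoc c a (sum A′)) above)

#positive : List ℤ → ℕ
#positive []       = 0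
#positive (x ∷ xs) = if positive? x then suc (#positive xs) else #positive xs

#positive-++ : ∀ xs ys → #positive (xs ++ ys) ≡ #positive xs + #positive ys
#positive-++ []       ys = refl
#positive-++ (x ∷ xs) ys with positive? x
... | true  = cong suc (#positive-++ xs ys)
... | false = #positive-++ xs ys

#positive-ascent : ∀ {A} → All (0 <_) A → #positive (ascent A) ≡ length A
#positive-ascent []           = refl
#positive-ascent (s≤s _ ∷ A⁺) = cong suc (#positive-ascent A⁺)

#positive-descent : ∀ B → #positive (descent B) ≡ 0
#positive-descent []          = refl
#positive-descent (zero  ∷ B) = #positive-descent B
#positive-descent (suc _ ∷ B) = #positive-descent B

#positive-∷⁺ : ∀ {w} → 0 < w → ∀ R → #positive (+ w ∷ R) ≡ suc (#positive R)
#positive-∷⁺ (s≤s _) R = refl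

#positive-peak : ∀ {A} B rest → All (0 <_) A → #positive (ascent A ++ descent B ++ rest) ≡ length A + #positive rest
#positive-peak {A} B rest A⁺ = begin
  #positive (ascent A ++ descent B ++ rest)
    ≡⟨ #positive-++ (ascent A) _ ⟩
  #positive (ascent A) + #positive (descent B ++ rest)
    ≡⟨ cong₂ _+_ (#positive-ascent A⁺) (#positive-++ (descent B) rest) ⟩
  length A + (#positive (descent B) + #positive rest)
    ≡⟨ cong (λ k → length A + (k + #positive rest)) (#positive-descent B) ⟩
  length A + #positive rest ∎
  where open ≡-Reasoning

-- The peaks of x are its consecutive pairs of runs; p and n are the ascent and descent parts of its cost.
data Blocks : List ℤ → ℕ → ℕ → Set where
  []   : Blocks [] 0 0
  peak : ∀ {A B rest p n} → All (0 <_) A → A ≢ [] → All (0 <_) B → B ≢ [] → Blocks rest p n →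
         Blocks (ascent A ++ descent B ++ rest) (maximum A + p) (maximum B + n)

Blocks-[] : ∀ {xs p n} → Blocks xs p n → xs ≡ [] → n ≡ 0
Blocks-[] []                             _  = refl
Blocks-[] (peak {A} _ A≢[] _ _ _) xs≡[] = ⊥-elim (A≢[] (map-≡[] A (++-conicalˡ (ascent A) _ xs≡[])))

Blocks-cast : ∀ {x x′ p p′ n n′} → x ≡ x′ → p ≡ p′ → n ≡ n′ → Blocks x p n → Blocks x′ p′ n′
Blocks-cast refl refl refl blocks = blocks

restack : ∀ A T Y → ascent (A ++ T) ++ Y ≡ ascent A ++ ascent T ++ Y
restack A T Y = trans (cong (_++ Y) (ascent-++ A T)) (++-assoc (ascent A) (ascent T) Y)

ReducibleWhenCheap : List ℤ → Set
ReducibleWhenCheap x = ∀ {p n} → Blocks x p n → Walk 0 x 0 → All (_≢ 0ℤ) x → n < #positive x → Reducible x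

ReducibleWhenCheapBelow : List ℤ → Set
ReducibleWhenCheapBelow x = ∀ {y} → length y < length x → ReducibleWhenCheap y

reducible-at-step-start : ∀ {p n h₀} A T B rest → Blocks rest p n → sum A ≡ h₀ → sum T ≡ sum B →
                          Walk h₀ rest 0 → All (0 <_) T → T ≢ [] →
                          All (_≢ 0ℤ) (ascent A ++ ascent T ++ descent B ++ rest) →
                          maximum B + n < length A + length T + #positive rest →
                          Reducible (ascent A ++ ascent T ++ descent B ++ rest)
reducible-at-step-start {h₀ = h₀} A T B rest blocks sum-A T≡B walk-rest T⁺ T≢[] nz cheap
  with maximum B ℕ.<? length T
... | yes wide =
  reducible-at-wide-peak (ascent A) T B rest (subst (Walk 0 (ascent A)) sum-A (ascent-walk 0 A))
    walk-rest T⁺ ℕ.≤-refl (cong (_+_ h₀) T≡B) wide nz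
... | no narrow = reducible-by-peak-excision A T B rest sum-A walk-rest T≡B T≢[] kept≢[] nz
  where
  kept≢[] : ascent A ++ rest ≢ []
  kept≢[] kept≡[] with map-≡[] A (++-conicalˡ (ascent A) rest kept≡[]) | ++-conicalʳ (ascent A) rest kept≡[]
  ... | refl | refl with refl ← Blocks-[] blocks refl =
    narrow (subst (maximum B <_) (ℕ.+-identityʳ (length T)) (ℕ.≤-<-trans (ℕ.m≤m+n (maximum B) 0) cheap))

shorter-after-shrinking : ∀ L {y z : ℤ} M N R → N ≢ [] → length (L ++ y ∷ R) < length (L ++ z ∷ M ++ N ++ R)
shorter-after-shrinking []      M []      R N≢[] = ⊥-elim (N≢[] refl)
shorter-after-shrinking []      M (_ ∷ N) R _    =
  s≤s (ℕ.≤-trans (s≤s (length-++-≤ʳ R {N})) (length-++-≤ʳ (_ ∷ N ++ R) {M}))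
shorter-after-shrinking (_ ∷ L) M N       R N≢[] = s≤s (shorter-after-shrinking L M N R N≢[])

-- The ascent a ∷ T followed by the descent B has net rise w = h₀ − sum A, so it can be collapsed to
-- the single step + w; a reduction of the shorter list expands back to one of the original.
reducible-by-shrinking : ∀ {p n h₀} A a T B rest →
                         ReducibleWhenCheapBelow (ascent A ++ ascent (a ∷ T) ++ descent B ++ rest) →
                         Blocks rest p n → All (0 <_) A → sum A < h₀ → sum A + (a + sum T) ≡ h₀ + sum B →
                         Walk h₀ rest 0 → B ≢ [] → All (_≢ 0ℤ) (ascent A ++ ascent (a ∷ T) ++ descent B ++ rest) →
                         n < length A + suc (#positive rest) →
                         Reducible (ascent A ++ ascent (a ∷ T) ++ descent B ++ rest)
reducible-by-shrinking A a T B _ _ [] _ below _ [] _ _ _ = ⊥-elim (ℕ.n≮0 below)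
reducible-by-shrinking {h₀ = h₀} A a T B _ ih (peak {C} {D} {rest} {p₂} {n₂} C⁺ _ D⁺ D≢[] blocks)
                       A⁺ below tops walk-rest B≢[] nz cheap =
  subst Reducible (cong (ascent A ++_) (++-assoc (ascent (a ∷ T)) (descent B) R))
    (reducible-by-expansion (ascent A) seg R w (λ ()) nz-seg seg-walk
      (ih (shorter-after-shrinking (ascent A) (ascent T) (descent B) R (B≢[] ∘ map-≡[] B)) blocks′ walk′ nz′ cheap′))
  where
  R = ascent C ++ descent D ++ rest
  seg = ascent (a ∷ T) ++ descent B
  w = h₀ ∸ sum A
  w>0 : 0 < w
  w>0 = ℕ.m<n⇒0<n∸m below
  sum-A+w : sum A + w ≡ h₀
  sum-A+w = ℕ.m+[n∸m]≡n (ℕ.<⇒≤ below)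
  rise : a + sum T ≡ w + sum B
  rise = ℕ.+-cancelˡ-≡ (sum A) _ _
           (trans tops (trans (cong (_+ sum B) (sym sum-A+w)) (ℕ.+-assoc (sum A) w (sum B))))
  seg-walk : ∀ h → Walk h seg (h + w)
  seg-walk h = walk-++ (ascent-walk h (a ∷ T))
    (subst (λ s → Walk s (descent B) (h + w)) (trans (ℕ.+-assoc h w (sum B)) (cong (_+_ h) (sym rise)))
      (descent-walk (h + w) B))
  blocks′ : Blocks (ascent A ++ + w ∷ R) (maximum (A ++ w ∷ C) + p₂) (maximum D + n₂)
  blocks′ = Blocks-cast (restack A (w ∷ C) (descent D ++ rest)) refl refl
              (peak (Allₚ.++⁺ A⁺ (w>0 ∷ C⁺)) ((λ ()) ∘ ++-conicalʳ A (w ∷ C)) D⁺ D≢[] blocks)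
  walk′ : Walk 0 (ascent A ++ + w ∷ R) 0
  walk′ = walk-++ (ascent-walk 0 A) (cong +_ sum-A+w ∷ walk-rest)
  nz-after-A = Allₚ.++⁻ʳ (ascent A) nz
  nz-seg : All (_≢ 0ℤ) seg
  nz-seg = Allₚ.++⁺ (Allₚ.++⁻ˡ (ascent (a ∷ T)) nz-after-A)
                    (Allₚ.++⁻ˡ (descent B) (Allₚ.++⁻ʳ (ascent (a ∷ T)) nz-after-A))
  nz′ : All (_≢ 0ℤ) (ascent A ++ + w ∷ R)
  nz′ = Allₚ.++⁺ (Allₚ.++⁻ˡ (ascent A) nz)
          ((λ w≡0 → ℕ.<⇒≢ w>0 (sym (ℤ.+-injective w≡0))) ∷ Allₚ.++⁻ʳ (descent B) (Allₚ.++⁻ʳ (ascent (a ∷ T)) nz-after-A))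
  cheap′ : maximum D + n₂ < #positive (ascent A ++ + w ∷ R)
  cheap′ = subst (_ <_) (sym (trans (#positive-++ (ascent A) _) (cong₂ _+_ (#positive-ascent A⁺) (#positive-∷⁺ w>0 R))))
    cheap

cheap-after-shrinking : ∀ m k l t r → t ≤ m → m + k < l + suc t + r → k < l + suc r
cheap-after-shrinking m k l t r t≤m cheap =
  ℕ.+-cancelˡ-< t k (l + suc r) (ℕ.≤-<-trans (ℕ.+-monoˡ-≤ k t≤m) (subst (m + k <_) (shuffle l t r) cheap))
  where
  shuffle : ∀ l t r → l + suc t + r ≡ t + (l + suc r)
  shuffle = ℕ-solve-∀

reducible-inside-step : ∀ {p n h₀} A a T B rest →
                        ReducibleWhenCheapBelow (ascent A ++ ascent (a ∷ T) ++ descent B ++ rest) →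
                        Blocks rest p n → All (0 <_) A → All (0 <_) T → sum A < h₀ → h₀ < sum A + a →
                        sum A + (a + sum T) ≡ h₀ + sum B → Walk h₀ rest 0 → B ≢ [] →
                        All (_≢ 0ℤ) (ascent A ++ ascent (a ∷ T) ++ descent B ++ rest) →
                        maximum B + n < length A + suc (length T) + #positive rest →
                        Reducible (ascent A ++ ascent (a ∷ T) ++ descent B ++ rest)
reducible-inside-step {n = n} A a T B rest ih blocks A⁺ T⁺ below above tops walk-rest B≢[] nz cheap
  with maximum B ℕ.<? length T
... | yes wide =
  subst Reducible (++-assoc (ascent A) [ + a ] _)
    (reducible-at-wide-peak (ascent A ++ [ + a ]) T B rest (walk-++ (ascent-walk 0 A) (refl ∷ [])) walk-rest T⁺
      (ℕ.<⇒≤ above) (trans (ℕ.+-assoc (sum A) a (sum T)) tops) wide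
      (subst (All _) (sym (++-assoc (ascent A) [ + a ] _)) nz))
... | no narrow =
  reducible-by-shrinking A a T B rest ih blocks A⁺ below tops walk-rest B≢[] nz
    (cheap-after-shrinking (maximum B) n (length A) (length T) (#positive rest) (ℕ.≮⇒≥ narrow) cheap)

reducible-when-cheap′ : ∀ {x} → Acc _<_ (length x) → ReducibleWhenCheap x
reducible-when-cheap′ _ [] _ _ ()
reducible-when-cheap′ (acc shorter) (peak {A} {B} {rest} A⁺ _ B⁺ B≢[] blocks) walk nz cheap
  with h₀ , sum-A , walk-rest ← peak-heights A B walk
  with crossing A z≤n (subst (h₀ <_) (sym sum-A) (ℕ.m<m+n h₀ (sum-positive B⁺ B≢[])))
... | at-step-start A₁ T at-h₀ T≢[] =
  subst Reducible (sym (restack A₁ T _))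
    (reducible-at-step-start A₁ T B rest blocks at-h₀ T≡B walk-rest (Allₚ.++⁻ʳ A₁ A⁺) T≢[]
      (subst (All _) (restack A₁ T _) nz) (subst (_ <_) positives cheap))
  where
  T≡B : sum T ≡ sum B
  T≡B = ℕ.+-cancelˡ-≡ h₀ _ _ (trans (cong (_+ sum T) (sym at-h₀)) (trans (sym (sum-++ A₁ T)) sum-A))
  positives : #positive (ascent (A₁ ++ T) ++ descent B ++ rest) ≡ length A₁ + length T + #positive rest
  positives = trans (#positive-peak B rest A⁺) (cong (_+ #positive rest) (length-++ A₁))
... | inside-step A₁ a T below above with _ ∷ T⁺ ← Allₚ.++⁻ʳ A₁ A⁺ =
  subst Reducible (sym (restack A₁ (a ∷ T) _))
    (reducible-inside-step A₁ a T B rest ih blocks (Allₚ.++⁻ˡ A₁ A⁺) T⁺ below above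
      (trans (sym (sum-++ A₁ (a ∷ T))) sum-A) walk-rest B≢[] (subst (All _) (restack A₁ (a ∷ T) _) nz)
      (subst (_ <_) (trans (#positive-peak B rest A⁺) (cong (_+ #positive rest) (length-++ A₁))) cheap))
  where
  ih : ReducibleWhenCheapBelow (ascent A₁ ++ ascent (a ∷ T) ++ descent B ++ rest)
  ih y< = reducible-when-cheap′ (shorter (subst (_ <_) (cong length (sym (restack A₁ (a ∷ T) _))) y<))

reducible-when-cheap : ∀ {x} → ReducibleWhenCheap x
reducible-when-cheap {x} = reducible-when-cheap′ (<-wellFounded (length x))

-- Runs, cost and width

SignRun : Bool → List ℤ → Set
SignRun b r = r ≢ [] × All (λ z → positive? z ≡ b) r

data Alternating : Bool → List (List ℤ) → Set where
  []  : ∀ {b} → Alternating b []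
  _∷_ : ∀ {b r rs} → SignRun b r → Alternating (not b) rs → Alternating b (r ∷ rs)

extend-run : ∀ {x b r rs} → positive? x ≡ b → Alternating b (r ∷ rs) → Alternating b ((x ∷ r) ∷ rs)
extend-run x≡b ((_ , r≡b) ∷ alt) = ((λ ()) , x≡b ∷ r≡b) ∷ alt

new-run : ∀ {x b rs} → positive? x ≡ b → Alternating (not b) rs → Alternating b ((x ∷ []) ∷ rs)
new-run x≡b alt = ((λ ()) , x≡b ∷ []) ∷ alt

resign : ∀ {y ys z zs rs b} → concat ((z ∷ zs) ∷ rs) ≡ y ∷ ys → positive? z ≡ b →
         Alternating (positive? y) ((z ∷ zs) ∷ rs) → Alternating b ((z ∷ zs) ∷ rs)
resign concat≡ z-sign = subst (λ b → Alternating b _) (trans (cong positive? (sym (∷-injectiveˡ concat≡))) z-sign)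

runs-alternate : ∀ x xs → concat (runs (x ∷ xs)) ≡ x ∷ xs × Alternating (positive? x) (runs (x ∷ xs))
runs-alternate x []       = refl , new-run refl []
runs-alternate x (y ∷ ys) with runs (y ∷ ys) | runs-alternate y ys
... | []              | () , _
... | [] ∷ _          | _ , ((r≢[] , _) ∷ _) = ⊥-elim (r≢[] refl)
... | (z ∷ zs) ∷ rs   | concat≡ , alt with positive? x in x-sign | positive? z in z-sign
...   | true  | true  = cong (x ∷_) concat≡ , extend-run x-sign (resign concat≡ z-sign alt)
...   | false | false = cong (x ∷_) concat≡ , extend-run x-sign (resign concat≡ z-sign alt)
...   | true  | false = cong (x ∷_) concat≡ , new-run x-sign (resign concat≡ z-sign alt)
...   | false | true  = cong (x ∷_) concat≡ , new-run x-sign (resign concat≡ z-sign alt)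

positive-run : ∀ {r} → All (λ z → positive? z ≡ true) r →
               ∃[ A ] r ≡ ascent A × All (0 <_) A × maxAbs r ≡ maximum A
positive-run []                       = [] , refl , [] , refl
positive-run {+ suc k ∷ _} (_ ∷ signs) =
  let A , r≡ , A⁺ , max≡ = positive-run signs
  in suc k ∷ A , cong (+ suc k ∷_) r≡ , s≤s z≤n ∷ A⁺ , cong (_⊔_ (suc k)) max≡

negative-run : ∀ {r} → All (λ z → positive? z ≡ false) r → All (_≢ 0ℤ) r →
               ∃[ B ] r ≡ descent B × All (0 <_) B × maxAbs r ≡ maximum B
negative-run []                 []            = [] , refl , [] , refl
negative-run {+ zero ∷ _} (_ ∷ _) (z≢0 ∷ _) = ⊥-elim (z≢0 refl)
negative-run { -[1+ k ] ∷ _} (_ ∷ signs) (_ ∷ nz) =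
  let B , r≡ , B⁺ , max≡ = negative-run signs nz
  in suc k ∷ B , cong (-[1+ k ] ∷_) r≡ , s≤s z≤n ∷ B⁺ , cong (_⊔_ (suc k)) max≡

-- A walk that returns to 0 cannot end with an ascending run, so the runs pair up into peaks.
blocks-of-runs : ∀ {h rs} → Alternating true rs → All (_≢ 0ℤ) (concat rs) → Walk h (concat rs) 0 →
                 ∃[ p ] ∃[ n ] Blocks (concat rs) p n × p + n ≡ sumℕ (mapL maxAbs rs)
blocks-of-runs [] _ _ = 0 , 0 , [] , refl
blocks-of-runs {h} ((r≢[] , signs) ∷ []) _ walk with positive-run signs
... | A , refl , A⁺ , _ with walk-++⁻ (ascent A) walk
...   | _ , walk-A , [] =
  ⊥-elim (ℕ.<⇒≢ (ℕ.<-≤-trans (sum-positive A⁺ (r≢[] ∘ cong ascent)) (ℕ.m≤n+m (sum A) h)) (ascent-walk-end A walk-A))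
blocks-of-runs ((r≢[] , signs) ∷ _∷_ {r = r′} (r′≢[] , signs′) alt) nz walk
  with positive-run signs
... | A , refl , A⁺ , maxA with negative-run signs′ (Allₚ.++⁻ˡ r′ (Allₚ.++⁻ʳ (ascent A) nz))
...   | B , refl , B⁺ , maxB =
  let _ , _ , walk-rest = peak-heights A B walk
      p , n , blocks , cost≡ = blocks-of-runs alt (Allₚ.++⁻ʳ (descent B) (Allₚ.++⁻ʳ (ascent A) nz)) walk-rest
  in maximum A + p , maximum B + n , peak A⁺ (r≢[] ∘ cong ascent) B⁺ (r′≢[] ∘ cong descent) blocks ,
     trans (shuffle (maximum A) p (maximum B) n) (cong₂ _+_ (sym maxA) (cong₂ _+_ (sym maxB) cost≡))
  where
  shuffle : ∀ a p b n → a + p + (b + n) ≡ a + (b + (p + n))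
  shuffle = ℕ-solve-∀

walk-starts-up : ∀ {x xs h} → Walk 0 (x ∷ xs) h → x ≢ 0ℤ → positive? x ≡ true
walk-starts-up {+ zero}  _ x≢0 = ⊥-elim (x≢0 refl)
walk-starts-up {+ suc _} _ _   = refl
walk-starts-up { -[1+ _ ]} (() ∷ _) _

blocks-of-walk : ∀ {xs} → Walk 0 xs 0 → All (_≢ 0ℤ) xs → ∃[ p ] ∃[ n ] Blocks xs p n × p + n ≡ cost xs
blocks-of-walk {[]}     _    _  = 0 , 0 , [] , refl
blocks-of-walk {x ∷ xs} walk nz with concat≡ , alt ← runs-alternate x xs =
  let p , n , blocks , cost≡ =
        blocks-of-runs (subst (λ b → Alternating b (runs (x ∷ xs))) (walk-starts-up walk (All.head nz)) alt)
          (subst (All (_≢ 0ℤ)) (sym concat≡) nz) (subst (λ ys → Walk 0 ys 0) (sym concat≡) walk)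
  in p , n , subst (λ ys → Blocks ys p n) concat≡ blocks , cost≡

#positive-mirror : ∀ {xs} → All (_≢ 0ℤ) xs → #positive xs + #positive (mirror xs) ≡ length xs
#positive-mirror {[]}     []          = refl
#positive-mirror {x ∷ xs} (x≢0 ∷ nz) = begin
  #positive (x ∷ xs) + #positive (mirror (x ∷ xs))
    ≡⟨ cong (λ ys → #positive (x ∷ xs) + #positive ys) (mirror-∷ x xs) ⟩
  #positive (x ∷ xs) + #positive (mirror xs ++ [ - x ])
    ≡⟨ cong (_+_ (#positive (x ∷ xs))) (#positive-++ (mirror xs) [ - x ]) ⟩
  #positive (x ∷ xs) + (#positive (mirror xs) + #positive [ - x ])
    ≡⟨ one-sign x x≢0 ⟩
  suc (#positive xs + #positive (mirror xs))
    ≡⟨ cong suc (#positive-mirror nz) ⟩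
  suc (length xs) ∎
  where
  open ≡-Reasoning
  one-sign : ∀ x → x ≢ 0ℤ → #positive (x ∷ xs) + (#positive (mirror xs) + #positive [ - x ])
                            ≡ suc (#positive xs + #positive (mirror xs))
  one-sign (+ zero)  x≢0 = ⊥-elim (x≢0 refl)
  one-sign (+ suc _) _   = cong (suc ∘ _+_ (#positive xs)) (ℕ.+-identityʳ _)
  one-sign -[1+ _ ]  _   = trans (cong (_+_ (#positive xs)) (ℕ.+-comm _ 1)) (ℕ.+-suc (#positive xs) _)

Blocks-snoc : ∀ {x p n C D} → Blocks x p n → All (0 <_) C → C ≢ [] → All (0 <_) D → D ≢ [] →
              Blocks (x ++ ascent C ++ descent D) (p + maximum C) (n + maximum D)
Blocks-snoc {C = C} {D} [] C⁺ C≢[] D⁺ D≢[] =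
  Blocks-cast (cong (ascent C ++_) (++-identityʳ (descent D))) (ℕ.+-identityʳ _) (ℕ.+-identityʳ _)
    (peak C⁺ C≢[] D⁺ D≢[] [])
Blocks-snoc (peak {A} {B} {rest} {p} {n} A⁺ A≢[] B⁺ B≢[] blocks) C⁺ C≢[] D⁺ D≢[] =
  Blocks-cast (sym (trans (++-assoc (ascent A) _ _) (cong (ascent A ++_) (++-assoc (descent B) rest _))))
    (sym (ℕ.+-assoc (maximum A) p _)) (sym (ℕ.+-assoc (maximum B) n _))
    (peak A⁺ A≢[] B⁺ B≢[] (Blocks-snoc blocks C⁺ C≢[] D⁺ D≢[]))

Blocks-mirror : ∀ {x p n} → Blocks x p n → Blocks (mirror x) n p
Blocks-mirror [] = []
Blocks-mirror (peak {A} {B} {rest} {p} {n} A⁺ A≢[] B⁺ B≢[] blocks) =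
  Blocks-cast mirrored (max-swap n B) (max-swap p A)
    (Blocks-snoc (Blocks-mirror blocks) (All-reverse⁺ B⁺) (reverse-≢[] B≢[]) (All-reverse⁺ A⁺) (reverse-≢[] A≢[]))
  where
  max-swap : ∀ k X → k + maximum (reverse X) ≡ maximum X + k
  max-swap k X = trans (cong (_+_ k) (maximum-reverse X)) (ℕ.+-comm k (maximum X))
  mirrored : mirror rest ++ ascent (reverse B) ++ descent (reverse A) ≡ mirror (ascent A ++ descent B ++ rest)
  mirrored = begin
    mirror rest ++ ascent (reverse B) ++ descent (reverse A)
      ≡⟨ cong₂ (λ b a → mirror rest ++ b ++ a) (mirror-descent B) (mirror-ascent A) ⟨
    mirror rest ++ mirror (descent B) ++ mirror (ascent A)
      ≡⟨ ++-assoc (mirror rest) _ _ ⟨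
    (mirror rest ++ mirror (descent B)) ++ mirror (ascent A)
      ≡⟨ cong (_++ mirror (ascent A)) (mirror-++ (descent B) rest) ⟨
    mirror (descent B ++ rest) ++ mirror (ascent A)
      ≡⟨ mirror-++ (ascent A) _ ⟨
    mirror (ascent A ++ descent B ++ rest) ∎
    where open ≡-Reasoning

<-of-sum-< : ∀ {p n a b} → p + n < a + b → n < a ⊎ p < b
<-of-sum-< {p} {n} {a} {b} p+n<a+b with n ℕ.<? a | p ℕ.<? b
... | yes n<a | _       = inj₁ n<a
... | no _    | yes p<b = inj₂ p<b
... | no n≮a  | no p≮b  =
  ⊥-elim (ℕ.<⇒≱ p+n<a+b (subst (a + b ≤_) (ℕ.+-comm n p) (ℕ.+-mono-≤ (ℕ.≮⇒≥ n≮a) (ℕ.≮⇒≥ p≮b))))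

theorem1p1 : (xs : List ℤ) → GenCatalan xs → cost xs < width xs → Reducible xs
theorem1p1 xs c cost<width =
  let p , n , blocks , cost≡ = blocks-of-walk walk nonzero
  in [ reducible-when-cheap blocks walk nonzero
     , (λ cheap-mirror → subst Reducible (mirror-involutive xs) (reducible-mirror
           (reducible-when-cheap (Blocks-mirror blocks) (walk-mirror walk) (mirror-nonzero nonzero) cheap-mirror)))
     ]′ (<-of-sum-< (subst₂ _<_ (sym cost≡) (sym (#positive-mirror nonzero)) cost<width))
  where
  open GenCatalan c
  walk : Walk 0 xs 0
  walk = catalan⇒walk c
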